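{- Let $\mathsf{C}$ be a category with an initial object $0$ and $(T,\mu,\eta)$ a monad on $\mathsf{C}$ such that $\mathcal{K}l(T)$ is $\mathbf{Cppo}$-enriched, and assume that $\perp\cdot f^\sharp=\perp$ for every morphism $f:X\to Y$ in $\mathsf{C}$ (with $\perp$ the least element of the relevant hom-set). For $\alpha:X\multimap X$ define $\mathrm{tr}_\alpha:X\multimap 0$ by $\mathrm{tr}_\alpha=\mu x.(x\cdot\alpha)=\bigvee_{n\in\mathbb{N}}\perp\cdot\alpha^{n}$. Then $\mathrm{tr}_{(-)}$ is a coalgebraic trace operator on $\mathcal{K}l(T)$, i.e. a fixed point operator on $\mathcal{K}l(T)$ that is uniform with respect to $(-)^\sharp:\mathsf{C}\to\mathcal{K}l(T)$.
   Context: $\mathcal{K}l(T)$: objects of $\mathsf{C}$, morphisms $X\multimap Y$ are $\mathsf{C}$-morphisms $X\to TY$, composition $g\cdot f=\mu_Z\circ Tg\circ f$, identities $\eta_X$; $f^\sharp=\eta_Y\circ f$ for $f:X\to Y$ in $\mathsf{C}$; $0$ is also initial in $\mathcal{K}l(T)$; $\alpha^0$ is the identity. $\mathbf{Cppo}$-enriched: every hom-set is a poset with least element $\perp$, ascending $\omega$-chains have suprema, and composition on either side preserves suprema of ascending $\omega$-chains (and is monotone). A fixed point operator on $\mathcal{K}l(T)$ is a family of maps $\mathrm{f}:Hom_{\mathcal{K}l(T)}(X,X)\to Hom_{\mathcal{K}l(T)}(X,0)$ with $\mathrm{f}(\alpha)\cdot\alpha=\mathrm{f}(\alpha)$ for all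 $\alpha:X\multimap X$. It is uniform w.r.t. $(-)^\sharp$ if for all $\alpha:X\multimap X$, $\beta:Y\multimap Y$ and $h:X\to Y$ in $\mathsf{C}$, $h^\sharp\cdot\alpha=\beta\cdot h^\sharp$ implies $\mathrm{f}(\beta)\cdot h^\sharp=\mathrm{f}(\alpha)$. A uniform fixed point operator is called a coalgebraic trace operator. -}

module Defs where

open import Level using (Level; _⊔_; suc)
open import Data.Nat using (ℕ; zero) renaming (suc to sucℕ)
open import Data.Product using (_×_; _,_)
open import Relation.Binary.Structures using (IsEquivalence; IsPartialOrder)

record Category (o ℓ e : Level) : Set (Level.suc (o ⊔ ℓ ⊔ e)) where
  infixr 9 _∘_
  infix 4 _≈_
  field
    Obj : Set o
    Hom : Obj → Obj → Set ℓ
    _≈_ : ∀ {A B} → Hom A B → Hom A B → Set e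
    ≈-equiv : ∀ {A B} → IsEquivalence (_≈_ {A} {B})
    id : ∀ {A} → Hom A A
    _∘_ : ∀ {A B C} → Hom B C → Hom A B → Hom A C
    assoc : ∀ {A B C D} {f : Hom A B} {g : Hom B C} {h : Hom C D} →
            (h ∘ g) ∘ f ≈ h ∘ (g ∘ f)
    identityˡ : ∀ {A B} {f : Hom A B} → id ∘ f ≈ f
    identityʳ : ∀ {A B} {f : Hom A B} → f ∘ id ≈ f
    ∘-resp-≈ : ∀ {A B C} {f h : Hom B C} {g i : Hom A B} →
               f ≈ h → g ≈ i → f ∘ g ≈ h ∘ i

record Initial {o ℓ e} (C : Category o ℓ e) : Set (o ⊔ ℓ ⊔ e) where
  open Category C
  field
    ⊥₀ : Obj
    ! : ∀ {A} → Hom ⊥₀ A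
    !-unique : ∀ {A} (f : Hom ⊥₀ A) → ! ≈ f

record Monad {o ℓ e} (C : Category o ℓ e) : Set (o ⊔ ℓ ⊔ e) where
  open Category C
  field
    F₀ : Obj → Obj
    F₁ : ∀ {A B} → Hom A B → Hom (F₀ A) (F₀ B)
    F-identity : ∀ {A} → F₁ (id {A}) ≈ id
    F-homomorphism : ∀ {A B C} {f : Hom A B} {g : Hom B C} →
                     F₁ (g ∘ f) ≈ F₁ g ∘ F₁ f
    F-resp-≈ : ∀ {A B} {f g : Hom A B} → f ≈ g → F₁ f ≈ F₁ g
    η : ∀ A → Hom A (F₀ A)
    μ : ∀ A → Hom (F₀ (F₀ A)) (F₀ A)
    η-natural : ∀ {A B} (f : Hom A B) → η B ∘ f ≈ F₁ f ∘ η A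
    μ-natural : ∀ {A B} (f : Hom A B) → μ B ∘ F₁ (F₁ f) ≈ F₁ f ∘ μ A
    μ-assoc : ∀ {A} → μ A ∘ F₁ (μ A) ≈ μ A ∘ μ (F₀ A)
    μ-identityˡ : ∀ {A} → μ A ∘ F₁ (η A) ≈ id
    μ-identityʳ : ∀ {A} → μ A ∘ η (F₀ A) ≈ id

module Kleisli {o ℓ e} {C : Category o ℓ e} (T : Monad C) where
  open Category C
  open Monad T

  _⊸_ : Obj → Obj → Set ℓ
  X ⊸ Y = Hom X (F₀ Y)

  infixr 9 _·_
  _·_ : ∀ {X Y Z} → Y ⊸ Z → X ⊸ Y → X ⊸ Z
  _·_ {Z = Z} g f = μ Z ∘ (F₁ g ∘ f)

  ηK : ∀ {X} → X ⊸ X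
  ηK {X} = η X

  _♯ : ∀ {X Y} → Hom X Y → X ⊸ Y
  _♯ {Y = Y} f = η Y ∘ f

  _^_ : ∀ {X} → X ⊸ X → ℕ → X ⊸ X
  α ^ zero = ηK
  α ^ sucℕ n = (α ^ n) · α

IsSup : ∀ {a r} {A : Set a} (_⊑_ : A → A → Set r) → (ℕ → A) → A → Set (a ⊔ r)
IsSup {A = A} _⊑_ c s = (∀ n → c n ⊑ s) × (∀ (u : A) → (∀ n → c n ⊑ u) → s ⊑ u)

record KlCppo {o ℓ e} {C : Category o ℓ e} (T : Monad C) (r : Level)
       : Set (o ⊔ ℓ ⊔ e ⊔ Level.suc r) where
  open Category C
  open Kleisli T
  infix 4 _⊑_
  field
    _⊑_ : ∀ {X Y} → X ⊸ Y → X ⊸ Y → Set r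
    ⊑-isPartialOrder : ∀ {X Y} → IsPartialOrder (_≈_ {X} {Monad.F₀ T Y}) (_⊑_ {X} {Y})
    ⊥ : ∀ {X Y} → X ⊸ Y
    ⊥-least : ∀ {X Y} (f : X ⊸ Y) → ⊥ ⊑ f
    ⨆ : ∀ {X Y} (c : ℕ → X ⊸ Y) → (∀ n → c n ⊑ c (sucℕ n)) → X ⊸ Y
    ⨆-isSup : ∀ {X Y} (c : ℕ → X ⊸ Y) (p : ∀ n → c n ⊑ c (sucℕ n)) →
              IsSup _⊑_ c (⨆ c p)
    ·-monoˡ : ∀ {X Y Z} {g g' : Y ⊸ Z} (f : X ⊸ Y) → g ⊑ g' → g · f ⊑ g' · f
    ·-monoʳ : ∀ {X Y Z} (g : Y ⊸ Z) {f f' : X ⊸ Y} → f ⊑ f' → g · f ⊑ g · f'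
    ·-⨆ˡ : ∀ {X Y Z} (c : ℕ → Y ⊸ Z) (p : ∀ n → c n ⊑ c (sucℕ n)) (f : X ⊸ Y) →
           IsSup _⊑_ (λ n → c n · f) (⨆ c p · f)
    ·-⨆ʳ : ∀ {X Y Z} (g : Y ⊸ Z) (c : ℕ → X ⊸ Y) (p : ∀ n → c n ⊑ c (sucℕ n)) →
           IsSup _⊑_ (λ n → g · c n) (g · ⨆ c p)

module Trace {o ℓ e r} {C : Category o ℓ e} (I : Initial C) (T : Monad C)
             (K : KlCppo T r) where
  open Category C
  open Initial I
  open Kleisli T
  open KlCppo K

  -- Kleene chain of x ↦ x · α starting at ⊥: c 0 = ⊥, c (n+1) = c n · α;
  -- c n ≈ ⊥ · αⁿ.
  kleene : ∀ {X} → X ⊸ X → ℕ → X ⊸ ⊥₀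
  kleene α zero = ⊥
  kleene α (sucℕ n) = kleene α n · α

  kleene-chain : ∀ {X} (α : X ⊸ X) (n : ℕ) → kleene α n ⊑ kleene α (sucℕ n)
  kleene-chain α zero = ⊥-least _
  kleene-chain α (sucℕ n) = ·-monoˡ α (kleene-chain α n)

  tr : ∀ {X} → X ⊸ X → X ⊸ ⊥₀
  tr α = ⨆ (kleene α) (kleene-chain α)

  IsFixedPointOperator : (∀ {X} → X ⊸ X → X ⊸ ⊥₀) → Set (o ⊔ ℓ ⊔ e)
  IsFixedPointOperator f = ∀ {X} (α : X ⊸ X) → f α · α ≈ f α

  IsUniform : (∀ {X} → X ⊸ X → X ⊸ ⊥₀) → Set (o ⊔ ℓ ⊔ e)
  IsUniform f = ∀ {X Y} (α : X ⊸ X) (β : Y ⊸ Y) (h : Hom X Y) →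
                (h ♯) · α ≈ β · (h ♯) → f β · (h ♯) ≈ f α

  IsCoalgebraicTraceOperator : (∀ {X} → X ⊸ X → X ⊸ ⊥₀) → Set (o ⊔ ℓ ⊔ e)
  IsCoalgebraicTraceOperator f = IsFixedPointOperator f × IsUniform f

-- tr α is the least fixed point of x ↦ x · α, computed as the supremum of the
-- Kleene chain ⊥, ⊥ · α, ⊥ · α², …; precomposing that chain with α shifts it,
-- which gives the fixed-point equation.  For uniformity, a commuting square
-- f · α ≈ β · f with a strict f (⊥ · f ≈ ⊥, as is h♯) makes precomposition
-- with f carry the Kleene chain of β termwise onto that of α, and
-- precomposition preserves the supremum.
module Submission where

open import Defs
open import Level using (Level)
open import Data.Nat using (ℕ; zero; suc)
open import Data.Product using (_,_)
open import Relation.Binary.Core using (Rel)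
open import Relation.Binary.Structures using (IsEquivalence; IsPartialOrder)
open import Relation.Binary.Bundles using (Setoid)
import Relation.Binary.Reasoning.Setoid as SetoidReasoning

module SupremumProperties {a ℓ r : Level} {A : Set a} {_≈_ : Rel A ℓ} {_⊑_ : Rel A r}
                          (isPartialOrder : IsPartialOrder _≈_ _⊑_) where
  open IsPartialOrder isPartialOrder

  IsSup-unique : ∀ {c : ℕ → A} {s t : A} → IsSup _⊑_ c s → IsSup _⊑_ c t → s ≈ t
  IsSup-unique (s-upper , s-least) (t-upper , t-least) =
    antisym (s-least _ t-upper) (t-least _ s-upper)

  IsSup-resp-≈ : ∀ {c d : ℕ → A} {s : A} → (∀ n → c n ≈ d n) →
                 IsSup _⊑_ c s → IsSup _⊑_ d s
  IsSup-resp-≈ c≈d (upper , least) =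
    (λ n → trans (reflexive (Eq.sym (c≈d n))) (upper n)) ,
    (λ u d⊑u → least u (λ n → trans (reflexive (c≈d n)) (d⊑u n)))

  IsSup-unshift : ∀ {c : ℕ → A} {s : A} → c 0 ⊑ c 1 →
                  IsSup _⊑_ (λ n → c (suc n)) s → IsSup _⊑_ c s
  IsSup-unshift {c} {s} c₀⊑c₁ (upper , least) = upper′ , λ u c⊑u → least u (λ n → c⊑u (suc n))
    where
    upper′ : ∀ n → c n ⊑ s
    upper′ zero    = trans c₀⊑c₁ (upper 0)
    upper′ (suc n) = upper n

module KleisliProperties {o ℓ e : Level} {C : Category o ℓ e} (T : Monad C) where
  open Category C
  open Monad T
  open Kleisli T
  module ≈ {A B} = IsEquivalence (≈-equiv {A} {B})

  hom-setoid : Obj → Obj → Setoid ℓ e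
  hom-setoid A B = record { Carrier = Hom A B ; _≈_ = _≈_ ; isEquivalence = ≈-equiv }

  ·-resp-≈ : ∀ {X Y Z} {g g′ : Y ⊸ Z} {f f′ : X ⊸ Y} → g ≈ g′ → f ≈ f′ → g · f ≈ g′ · f′
  ·-resp-≈ g≈g′ f≈f′ = ∘-resp-≈ ≈.refl (∘-resp-≈ (F-resp-≈ g≈g′) f≈f′)

  ·-assoc : ∀ {W X Y Z} (g : Y ⊸ Z) (f : X ⊸ Y) (k : W ⊸ X) → (g · f) · k ≈ g · (f · k)
  ·-assoc {W} {X} {Y} {Z} g f k = begin
      μ Z ∘ (F₁ (μ Z ∘ (F₁ g ∘ f)) ∘ k)
    ≈⟨ ∘-resp-≈ ≈.refl (∘-resp-≈ (≈.trans F-homomorphism (∘-resp-≈ ≈.refl F-homomorphism)) ≈.refl) ⟩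
      μ Z ∘ ((F₁ (μ Z) ∘ (F₁ (F₁ g) ∘ F₁ f)) ∘ k)
    ≈⟨ ∘-resp-≈ ≈.refl assoc ⟩
      μ Z ∘ (F₁ (μ Z) ∘ ((F₁ (F₁ g) ∘ F₁ f) ∘ k))
    ≈⟨ ≈.sym assoc ⟩
      (μ Z ∘ F₁ (μ Z)) ∘ ((F₁ (F₁ g) ∘ F₁ f) ∘ k)
    ≈⟨ ∘-resp-≈ μ-assoc ≈.refl ⟩
      (μ Z ∘ μ (F₀ Z)) ∘ ((F₁ (F₁ g) ∘ F₁ f) ∘ k)
    ≈⟨ assoc ⟩
      μ Z ∘ (μ (F₀ Z) ∘ ((F₁ (F₁ g) ∘ F₁ f) ∘ k))
    ≈⟨ ∘-resp-≈ ≈.refl (∘-resp-≈ ≈.refl assoc) ⟩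
      μ Z ∘ (μ (F₀ Z) ∘ (F₁ (F₁ g) ∘ (F₁ f ∘ k)))
    ≈⟨ ∘-resp-≈ ≈.refl (≈.sym assoc) ⟩
      μ Z ∘ ((μ (F₀ Z) ∘ F₁ (F₁ g)) ∘ (F₁ f ∘ k))
    ≈⟨ ∘-resp-≈ ≈.refl (∘-resp-≈ (μ-natural g) ≈.refl) ⟩
      μ Z ∘ ((F₁ g ∘ μ Y) ∘ (F₁ f ∘ k))
    ≈⟨ ∘-resp-≈ ≈.refl assoc ⟩
      μ Z ∘ (F₁ g ∘ (μ Y ∘ (F₁ f ∘ k)))
    ∎
    where open SetoidReasoning (hom-setoid W (F₀ Z))

module TraceProperties {o ℓ e r : Level} {C : Category o ℓ e}
                       (I : Initial C) (T : Monad C) (K : KlCppo T r) where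
  open Category C using (_≈_)
  open Kleisli T
  open KlCppo K
  open Trace I T K
  open KleisliProperties T
  module _ {X Y : Category.Obj C} where
    open SupremumProperties (⊑-isPartialOrder {X} {Y}) public

  tr-isSup : ∀ {X} (α : X ⊸ X) → IsSup _⊑_ (kleene α) (tr α)
  tr-isSup α = ⨆-isSup (kleene α) (kleene-chain α)

  tr-fixedPoint : IsFixedPointOperator tr
  tr-fixedPoint α = IsSup-unique
    (IsSup-unshift (kleene-chain α 0) (·-⨆ˡ (kleene α) (kleene-chain α) α))
    (tr-isSup α)

  kleene-intertwine : ∀ {X Y} {α : X ⊸ X} {β : Y ⊸ Y} {f : X ⊸ Y} →
                      ⊥ · f ≈ ⊥ → f · α ≈ β · f → ∀ n → kleene β n · f ≈ kleene α n
  kleene-intertwine ⊥-strict square zero = ⊥-strict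
  kleene-intertwine {X} {α = α} {β} {f} ⊥-strict square (suc n) = begin
    (kleene β n · β) · f   ≈⟨ ·-assoc _ _ _ ⟩
    kleene β n · (β · f)   ≈⟨ ·-resp-≈ ≈.refl (≈.sym square) ⟩
    kleene β n · (f · α)   ≈⟨ ≈.sym (·-assoc _ _ _) ⟩
    (kleene β n · f) · α   ≈⟨ ·-resp-≈ (kleene-intertwine ⊥-strict square n) ≈.refl ⟩
    kleene α n · α         ∎
    where open SetoidReasoning (hom-setoid X _)

  tr-intertwine : ∀ {X Y} {α : X ⊸ X} {β : Y ⊸ Y} {f : X ⊸ Y} →
                  ⊥ · f ≈ ⊥ → f · α ≈ β · f → tr β · f ≈ tr α
  tr-intertwine ⊥-strict square = IsSup-unique
    (IsSup-resp-≈ (kleene-intertwine ⊥-strict square) (·-⨆ˡ _ (kleene-chain _) _))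
    (tr-isSup _)

theorem10 : ∀ {o ℓ e r : Level} {C : Category o ℓ e} (I : Initial C) (T : Monad C) (K : KlCppo T r) →
    (∀ {X Y Z} (f : Category.Hom C X Y) →
    Category._≈_ C (Kleisli._·_ T (KlCppo.⊥ K {Y} {Z}) (Kleisli._♯ T f)) (KlCppo.⊥ K {X} {Z})) →
    Trace.IsCoalgebraicTraceOperator I T K (Trace.tr I T K)
theorem10 I T K ⊥-♯-strict =
  tr-fixedPoint , λ α β h square → tr-intertwine (⊥-♯-strict h) square
  where open TraceProperties I T K
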